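{- If $\Gamma\vdash t:A$ and $t$ has no free variables, then every type occurring in $\Gamma$ is a base qubit type, i.e. $|\Gamma|\subseteq\mathcal B$.
   Context: The calculus. Scalars $\alpha\in\mathbb C$. Base qubit types $B ::= \mathbb B \mid B\otimes B$; $\mathcal B$ denotes the set of base qubit types. Qubit types $\Psi ::= B \mid S(\Psi)\mid \Psi\otimes\Psi$; types $A ::= \Psi\mid \Psi\Rightarrow A\mid S(A)\mid A\otimes A$. Base terms $b ::= x \mid \lambda x{:}\Psi.\,t \mid |0\rangle\mid |1\rangle\mid b\otimes b$; terms $t ::= b\mid\vec 0\mid t\,t\mid t+t\mid \pi_j t\mid \mathsf{ite}\mid \alpha.t\mid t\otimes t\mid \mathsf{head}\,t\mid \mathsf{tail}\,t\mid \Uparrow^{A}_{B\otimes C} t$ ($\vec 0_A$ null-vector constants, $\mathsf{ite}$ constant, $\pi_j$ measurement, $\Uparrow$ cast). Contexts $\Gamma$ assign qubit types to variables; $\Gamma,\Delta$ has disjoint supports; $|\Gamma|$ is the set of types occurring in $\Gamma$. Subtyping $\preceq$: reflexive-transitive relation generated by $A\preceq S(A)$, $S(S(A))\preceq S(A)$, and if $A\preceq B$ then $\Psi\Rightarrow A\preceq\Psi\Rightarrow B$, $S(A)\preceq S(B)$, $A\otimes C\preceq B\otimes C$, $C\otimes A\preceq C\otimes B$. $Q_n^S$ ($S\subseteq\{1,\dots,n\}$): $A_0^{\emptyset}(X)=X$; $A_{k+1}^S(\mathbb B)=A_k^S(\mathbb B)\otimes\mathbb B$ if $k+1\notin S$,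 else $A_k^{S\setminus\{k+1\}}(S(\mathbb B))\otimes\mathbb B$; $A_{k+1}^S(S(X))=A_k^S(\mathbb B)\otimes S(X)$ if $k+1\notin S$, else $A_k^{S\setminus\{k+1\}}(S(\mathbb B\otimes X))$; $Q_n^S=A_{n-1}^S(\mathbb B)$ if $n\notin S$, else $A_{n-1}^{S\setminus\{n\}}(S(\mathbb B))$. Typing rules: $x:\Psi\vdash x:\Psi$; $\vdash\vec 0_A:S(A)$; $\vdash|0\rangle:\mathbb B$; $\vdash|1\rangle:\mathbb B$; $\Gamma\vdash t:A$ gives $\Gamma\vdash\alpha.t:S(A)$; $\Gamma\vdash t:A$, $\Delta\vdash u:A$ give $\Gamma,\Delta\vdash t+u:S(A)$; $\Gamma\vdash t:Q_n^S$ gives $\Gamma\vdash\pi_jt:Q_n^{S\setminus\{1,\dots,j\}}$; $\Gamma\vdash t:A$, $A\preceq B$ give $\Gamma\vdash t:B$; $\vdash\mathsf{ite}:\mathbb B\Rightarrow\mathbb B\Rightarrow\mathbb B\Rightarrow\mathbb B$; $\Gamma,x:\Psi\vdash t:A$ gives $\Gamma\vdash\lambda x{:}\Psi.\,t:\Psi\Rightarrow A$; $\Gamma\vdash t:\Psi\Rightarrow A$, $\Delta\vdash u:\Psi$ give $\Gamma,\Delta\vdash tu:A$; $\Gamma\vdash t:S(\Psi\Rightarrow A)$, $\Delta\vdash u:S(\Psi)$ give $\Gamma,\Delta\vdash tu:S(A)$; weakening $\Gamma,x:B\vdash t:A$ from $\Gamma\vdash t:A$ and contraction $\Gamma,x:B\vdash(x/y)t:A$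 from $\Gamma,x:B,y:B\vdash t:A$ ($B\in\mathcal B$); $\Gamma\vdash t:A$, $\Delta\vdash u:B$ give $\Gamma,\Delta\vdash t\otimes u:A\otimes B$; $\Gamma\vdash t:\mathbb B\otimes B$ gives $\Gamma\vdash\mathsf{head}\,t:\mathbb B$, $\Gamma\vdash\mathsf{tail}\,t:B$; $\Gamma\vdash t:S(S(A)\otimes B)$ gives $\Gamma\vdash\Uparrow^{S(A)\otimes B}_{A\otimes B}t:S(A\otimes B)$; $\Gamma\vdash t:S(A\otimes S(B))$ gives $\Gamma\vdash\Uparrow^{A\otimes S(B)}_{A\otimes B}t:S(A\otimes B)$; $\Gamma\vdash\Uparrow^B_At:S(A)$ gives $\Gamma\vdash\Uparrow^B_A\alpha.t:S(A)$; $\Gamma\vdash\Uparrow^B_At:S(A)$, $\Delta\vdash\Uparrow^B_Ar:S(A)$ give $\Gamma,\Delta\vdash\Uparrow^B_A(t+r):S(A)$. -}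

module Defs where

open import Data.Nat using (ℕ; zero; suc; _<ᵇ_; _≟_)
open import Data.Bool using (Bool; true; false; if_then_else_; _∧_; not)
open import Data.Fin using (Fin; fromℕ; inject₁; toℕ)
open import Data.List using (List; []; _∷_; _++_; map; filter)
open import Data.List.Membership.Propositional using (_∉_)
open import Data.List.Relation.Binary.Disjoint.Propositional using (Disjoint)
open import Data.List.Relation.Binary.Permutation.Propositional using (_↭_)
open import Data.List.Relation.Unary.All using (All)
open import Data.Product using (_×_; _,_; proj₁; proj₂)
open import Relation.Nullary using (¬?; yes; no)
open import Function using (_∘_)

infixr 7 _⊗_
infixr 5 _⇒_

-- Types (raw syntax; the grammar's categories are carved out below)

data Ty : Set where
  𝔹   : Ty
  S   : Ty → Ty
  _⊗_ : Ty → Ty → Ty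
  _⇒_ : Ty → Ty → Ty

data IsBase : Ty → Set where
  𝔹   : IsBase 𝔹
  _⊗_ : ∀ {B C} → IsBase B → IsBase C → IsBase (B ⊗ C)

data IsQubit : Ty → Set where
  base : ∀ {B} → IsBase B → IsQubit B
  S    : ∀ {Ψ} → IsQubit Ψ → IsQubit (S Ψ)
  _⊗_  : ∀ {Ψ Φ} → IsQubit Ψ → IsQubit Φ → IsQubit (Ψ ⊗ Φ)

data IsType : Ty → Set where
  qubit : ∀ {Ψ} → IsQubit Ψ → IsType Ψ
  _⇒_   : ∀ {Ψ A} → IsQubit Ψ → IsType A → IsType (Ψ ⇒ A)
  S     : ∀ {A} → IsType A → IsType (S A)
  _⊗_   : ∀ {A C} → IsType A → IsType C → IsType (A ⊗ C)

infix 4 _≼_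
data _≼_ : Ty → Ty → Set where
  ≼-refl  : ∀ {A} → A ≼ A
  ≼-trans : ∀ {A B C} → A ≼ B → B ≼ C → A ≼ C
  ≼-S     : ∀ {A} → A ≼ S A
  ≼-SS    : ∀ {A} → S (S A) ≼ S A
  ≼-⇒     : ∀ {Ψ A B} → A ≼ B → (Ψ ⇒ A) ≼ (Ψ ⇒ B)
  ≼-Scong : ∀ {A B} → A ≼ B → S A ≼ S B
  ≼-⊗ˡ    : ∀ {A B C} → A ≼ B → (A ⊗ C) ≼ (B ⊗ C)
  ≼-⊗ʳ    : ∀ {A B C} → A ≼ B → (C ⊗ A) ≼ (C ⊗ B)

-- A subset S ⊆ {1,…,k} is a function Fin k → Bool,
-- where index i : Fin k stands for the element (toℕ i + 1).
-- For S : Fin (suc k) → Bool, "k+1 ∈ S" is S (fromℕ k), and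
-- S \ {k+1}, viewed as a subset of {1,…,k}, is S ∘ inject₁.

A[_] : (k : ℕ) → (Fin k → Bool) → Ty → Ty
A[ zero  ] S' X = X
A[ suc k ] S' 𝔹 =
  if S' (fromℕ k) then A[ k ] (S' ∘ inject₁) (S 𝔹) ⊗ 𝔹
                  else A[ k ] (S' ∘ inject₁) 𝔹 ⊗ 𝔹
A[ suc k ] S' (S X) =
  if S' (fromℕ k) then A[ k ] (S' ∘ inject₁) (S (𝔹 ⊗ X))
                  else A[ k ] (S' ∘ inject₁) 𝔹 ⊗ S X
-- the remaining shapes of X never arise from Q (below); value irrelevant
A[ suc k ] S' (X ⊗ Y) = X ⊗ Y
A[ suc k ] S' (X ⇒ Y) = X ⇒ Y

Q : (n : ℕ) → (Fin n → Bool) → Ty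
Q zero    S' = 𝔹   -- Q_0 is not used (no rule mentions it)
Q (suc m) S' =
  if S' (fromℕ m) then A[ m ] (S' ∘ inject₁) (S 𝔹)
                  else A[ m ] (S' ∘ inject₁) 𝔹

removeUpTo : ∀ {n} → ℕ → (Fin n → Bool) → (Fin n → Bool)
removeUpTo j S' i = S' i ∧ not (toℕ i <ᵇ j)

-- Terms, over an arbitrary set K of scalars (the paper uses K = ℂ).
-- Variables are natural numbers.

Var : Set
Var = ℕ

data Term (K : Set) : Set where
  var   : Var → Term K
  lam   : Var → Ty → Term K → Term K
  ket0  : Term K
  ket1  : Term K
  vec0  : Ty → Term K
  app   : Term K → Term K → Term K
  plus  : Term K → Term K → Term K
  proj  : ℕ → Term K → Term K
  ite   : Term K
  scal  : K → Term K → Term K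
  tens  : Term K → Term K → Term K
  head  : Term K → Term K
  tail  : Term K → Term K
  cast  : Ty → Ty → Term K → Term K

FV : ∀ {K} → Term K → List Var
FV (var x)      = x ∷ []
FV (lam x _ t)  = filter (λ y → ¬? (y ≟ x)) (FV t)
FV ket0         = []
FV ket1         = []
FV (vec0 _)     = []
FV (app t u)    = FV t ++ FV u
FV (plus t u)   = FV t ++ FV u
FV (proj _ t)   = FV t
FV ite          = []
FV (scal _ t)   = FV t
FV (tens t u)   = FV t ++ FV u
FV (head t)     = FV t
FV (tail t)     = FV t
FV (cast _ _ t) = FV t

-- (x/y)t : replace free occurrences of y by x (variable convention:
-- bound variables are assumed distinct from x).
_/_[_] : ∀ {K} → Var → Var → Term K → Term K
x / y [ var z ] with z ≟ y
... | yes _ = var x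
... | no  _ = var z
x / y [ lam z Ψ t ] with z ≟ y
... | yes _ = lam z Ψ t
... | no  _ = lam z Ψ (x / y [ t ])
x / y [ ket0 ]       = ket0
x / y [ ket1 ]       = ket1
x / y [ vec0 A ]     = vec0 A
x / y [ app t u ]    = app (x / y [ t ]) (x / y [ u ])
x / y [ plus t u ]   = plus (x / y [ t ]) (x / y [ u ])
x / y [ proj j t ]   = proj j (x / y [ t ])
x / y [ ite ]        = ite
x / y [ scal α t ]   = scal α (x / y [ t ])
x / y [ tens t u ]   = tens (x / y [ t ]) (x / y [ u ])
x / y [ head t ]     = head (x / y [ t ])
x / y [ tail t ]     = tail (x / y [ t ])
x / y [ cast B A t ] = cast B A (x / y [ t ])

-- Contexts: lists of (variable, type); Γ,Δ is Γ ++ Δ with disjoint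
-- supports; contexts are considered up to permutation (rule `exch`).

Ctx : Set
Ctx = List (Var × Ty)

dom : Ctx → List Var
dom = map proj₁

types : Ctx → List Ty
types = map proj₂

infix 3 _⊢_∶_
data _⊢_∶_ {K : Set} : Ctx → Term K → Ty → Set where
  ax     : ∀ {x Ψ} → IsQubit Ψ → ((x , Ψ) ∷ []) ⊢ var x ∶ Ψ
  ax0⃗    : ∀ {A} → IsType A → [] ⊢ vec0 A ∶ S A
  ax|0⟩  : [] ⊢ ket0 ∶ 𝔹
  ax|1⟩  : [] ⊢ ket1 ∶ 𝔹
  sI     : ∀ {Γ t A} (α : K) → Γ ⊢ t ∶ A → Γ ⊢ scal α t ∶ S A
  sI⁺    : ∀ {Γ Δ t u A} → Disjoint (dom Γ) (dom Δ) →
           Γ ⊢ t ∶ A → Δ ⊢ u ∶ A → Γ ++ Δ ⊢ plus t u ∶ S A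
  meas   : ∀ {Γ t n} {S' : Fin (suc n) → Bool} (j : ℕ) →
           Γ ⊢ t ∶ Q (suc n) S' →
           Γ ⊢ proj j t ∶ Q (suc n) (removeUpTo j S')
  sub    : ∀ {Γ t A B} → Γ ⊢ t ∶ A → A ≼ B → Γ ⊢ t ∶ B
  axite  : [] ⊢ ite ∶ 𝔹 ⇒ 𝔹 ⇒ 𝔹 ⇒ 𝔹
  ⇒I     : ∀ {Γ x Ψ t A} → IsQubit Ψ → x ∉ dom Γ →
           Γ ++ ((x , Ψ) ∷ []) ⊢ t ∶ A → Γ ⊢ lam x Ψ t ∶ Ψ ⇒ A
  ⇒E     : ∀ {Γ Δ t u Ψ A} → Disjoint (dom Γ) (dom Δ) →
           Γ ⊢ t ∶ Ψ ⇒ A → Δ ⊢ u ∶ Ψ → Γ ++ Δ ⊢ app t u ∶ A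
  ⇒ES    : ∀ {Γ Δ t u Ψ A} → Disjoint (dom Γ) (dom Δ) →
           Γ ⊢ t ∶ S (Ψ ⇒ A) → Δ ⊢ u ∶ S Ψ → Γ ++ Δ ⊢ app t u ∶ S A
  weak   : ∀ {Γ x B t A} → IsBase B → x ∉ dom Γ →
           Γ ⊢ t ∶ A → Γ ++ ((x , B) ∷ []) ⊢ t ∶ A
  contr  : ∀ {Γ x y B t A} → IsBase B →
           Γ ++ ((x , B) ∷ (y , B) ∷ []) ⊢ t ∶ A →
           Γ ++ ((x , B) ∷ []) ⊢ x / y [ t ] ∶ A
  ⊗I     : ∀ {Γ Δ t u A B} → Disjoint (dom Γ) (dom Δ) →
           Γ ⊢ t ∶ A → Δ ⊢ u ∶ B → Γ ++ Δ ⊢ tens t u ∶ A ⊗ B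
  ⊗Er    : ∀ {Γ t B} → IsBase B → Γ ⊢ t ∶ 𝔹 ⊗ B → Γ ⊢ head t ∶ 𝔹
  ⊗El    : ∀ {Γ t B} → IsBase B → Γ ⊢ t ∶ 𝔹 ⊗ B → Γ ⊢ tail t ∶ B
  ⇑r     : ∀ {Γ t A B} → Γ ⊢ t ∶ S (S A ⊗ B) →
           Γ ⊢ cast (S A ⊗ B) (A ⊗ B) t ∶ S (A ⊗ B)
  ⇑l     : ∀ {Γ t A B} → Γ ⊢ t ∶ S (A ⊗ S B) →
           Γ ⊢ cast (A ⊗ S B) (A ⊗ B) t ∶ S (A ⊗ B)
  ⇑α     : ∀ {Γ t A B} (α : K) → Γ ⊢ cast B A t ∶ S A →
           Γ ⊢ cast B A (scal α t) ∶ S A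
  ⇑+     : ∀ {Γ Δ t r A B} → Disjoint (dom Γ) (dom Δ) →
           Γ ⊢ cast B A t ∶ S A → Δ ⊢ cast B A r ∶ S A →
           Γ ++ Δ ⊢ cast B A (plus t r) ∶ S A
  exch   : ∀ {Γ Γ' t A} → Γ ↭ Γ' → Γ ⊢ t ∶ A → Γ' ⊢ t ∶ A

module Submission where

-- The proof is an invariant of typing derivations.  Say that a context Γ
-- is *covered* by a list of variables L when every variable of Γ whose
-- type is not a base type belongs to L.  We show that in every derivation
-- of  Γ ⊢ t ∶ A  the context Γ is covered by FV t: the axiom for variables
-- puts x into FV (var x), the splitting rules combine coverings along
-- Γ ++ Δ, and weakening and contraction only introduce variables of base
-- type.  The two binding-like rules (λ-abstraction, which removes x from
-- the free variables, and contraction, which renames y into x) erase one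
-- variable from FV t; this is harmless because that variable does not
-- occur in the rest of the context.  For that we first show that the
-- domain of every derivable context is duplicate-free.  If t is closed,
-- a context covered by FV t = [] consists of base types only.

open import Defs
open import Data.List using ([])
open import Data.List.Relation.Unary.All using (All)
open import Relation.Binary.PropositionalEquality using (_≡_)

open import Data.List using (List; _∷_; _++_)
open import Data.List.Properties using (map-++; ++-assoc)
open import Data.List.Relation.Unary.All using ([]; _∷_; lookup)
import Data.List.Relation.Unary.All as All
import Data.List.Relation.Unary.All.Properties as AllP
open import Data.List.Relation.Unary.Any using (here; there)
open import Data.List.Relation.Unary.AllPairs using ([]; _∷_)
open import Data.List.Relation.Unary.Unique.Propositional using (Unique)
import Data.List.Relation.Unary.Unique.Propositional.Properties as UniqueP
open import Data.List.Membership.Propositional using (_∈_; _∉_)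
open import Data.List.Membership.Propositional.Properties
  using (∈-++⁺ˡ; ∈-++⁺ʳ; ∈-++⁻; ∈-filter⁺; ∈-filter⁻)
open import Data.List.Relation.Binary.Permutation.Propositional using (↭⇒↭ₛ)
open import Data.List.Relation.Binary.Permutation.Propositional.Properties
  using (All-resp-↭)
import Data.List.Relation.Binary.Permutation.Propositional.Properties as PermP
import Data.List.Relation.Binary.Permutation.Setoid.Properties as PermSetoidP
open import Data.List.Relation.Binary.Disjoint.Propositional using (Disjoint)
open import Data.Nat using (_≟_)
open import Data.Product using (_×_; _,_; proj₁; proj₂)
open import Data.Sum using (_⊎_; inj₁; inj₂)
open import Data.Empty using (⊥-elim)
open import Relation.Nullary using (¬?; yes; no)
open import Relation.Binary.PropositionalEquality
  using (_≢_; refl; sym; subst; setoid)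

unique-++ˡ : ∀ {A : Set} (xs : List A) {ys} → Unique (xs ++ ys) → Unique xs
unique-++ˡ []       _          = []
unique-++ˡ (x ∷ xs) (x∉ ∷ xs!) = AllP.++⁻ˡ xs x∉ ∷ unique-++ˡ xs xs!

unique-++-disjoint : ∀ {A : Set} (xs : List A) {ys} →
                     Unique (xs ++ ys) → Disjoint xs ys
unique-++-disjoint (x ∷ xs) (x∉ ∷ _)   (here refl , y∈ys) =
  lookup (AllP.++⁻ʳ xs x∉) y∈ys refl
unique-++-disjoint (x ∷ xs) (_ ∷ xs!) (there y∈xs , y∈ys) =
  unique-++-disjoint xs xs! (y∈xs , y∈ys)

unique-contract : ∀ {A : Set} (xs : List A) {x y} → Unique (xs ++ x ∷ y ∷ []) →
                  Unique (xs ++ x ∷ []) × y ∉ xs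
unique-contract xs {x} {y} xs! =
    unique-++ˡ (xs ++ x ∷ []) xs!′
  , λ y∈xs → unique-++-disjoint (xs ++ x ∷ []) xs!′ (∈-++⁺ˡ y∈xs , here refl)
  where
  xs!′ : Unique ((xs ++ x ∷ []) ++ y ∷ [])
  xs!′ = subst Unique (sym (++-assoc xs (x ∷ []) (y ∷ []))) xs!

dom-++ : (Γ Δ : Ctx) → dom (Γ ++ Δ) ≡ dom Γ ++ dom Δ
dom-++ Γ Δ = map-++ proj₁ Γ Δ

unique-dom-++ : ∀ {Γ Δ : Ctx} → Disjoint (dom Γ) (dom Δ) →
                Unique (dom Γ) → Unique (dom Δ) → Unique (dom (Γ ++ Δ))
unique-dom-++ {Γ} {Δ} Γ#Δ Γ! Δ! =
  subst Unique (sym (dom-++ Γ Δ)) (UniqueP.++⁺ Γ! Δ! Γ#Δ)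

unique-dom-snoc : ∀ {Γ : Ctx} {x T} → x ∉ dom Γ →
                  Unique (dom Γ) → Unique (dom (Γ ++ (x , T) ∷ []))
unique-dom-snoc x∉Γ Γ! =
  unique-dom-++ (λ { (x∈Γ , here refl) → x∉Γ x∈Γ }) Γ! ([] ∷ [])

contraction-dom : ∀ (Γ : Ctx) {x y} {B : Ty} →
                  Unique (dom (Γ ++ (x , B) ∷ (y , B) ∷ [])) →
                  Unique (dom Γ ++ x ∷ y ∷ [])
contraction-dom Γ {x} {y} {B} = subst Unique (dom-++ Γ ((x , B) ∷ (y , B) ∷ []))

-- Every derivable context has a duplicate-free domain: the splitting rules
-- require disjoint domains and the remaining rules only add fresh variables.
unique-dom : ∀ {K} {Γ : Ctx} {t : Term K} {A} → Γ ⊢ t ∶ A → Unique (dom Γ)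
unique-dom (ax _)           = [] ∷ []
unique-dom (ax0⃗ _)          = []
unique-dom ax|0⟩            = []
unique-dom ax|1⟩            = []
unique-dom axite            = []
unique-dom (sI _ d)         = unique-dom d
unique-dom (meas _ d)       = unique-dom d
unique-dom (sub d _)        = unique-dom d
unique-dom (⊗Er _ d)        = unique-dom d
unique-dom (⊗El _ d)        = unique-dom d
unique-dom (⇑r d)           = unique-dom d
unique-dom (⇑l d)           = unique-dom d
unique-dom (⇑α _ d)         = unique-dom d
unique-dom (sI⁺ Γ#Δ d e)    = unique-dom-++ Γ#Δ (unique-dom d) (unique-dom e)
unique-dom (⇒E Γ#Δ d e)     = unique-dom-++ Γ#Δ (unique-dom d) (unique-dom e)
unique-dom (⇒ES Γ#Δ d e)    = unique-dom-++ Γ#Δ (unique-dom d) (unique-dom e)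
unique-dom (⊗I Γ#Δ d e)     = unique-dom-++ Γ#Δ (unique-dom d) (unique-dom e)
unique-dom (⇑+ Γ#Δ d e)     = unique-dom-++ Γ#Δ (unique-dom d) (unique-dom e)
unique-dom (⇒I {Γ} {x} {Ψ} _ _ d) =
  unique-++ˡ (dom Γ) (subst Unique (dom-++ Γ ((x , Ψ) ∷ [])) (unique-dom d))
unique-dom (weak _ x∉Γ d)   = unique-dom-snoc x∉Γ (unique-dom d)
unique-dom (contr {Γ} {x} {B = B} _ d) =
  subst Unique (sym (dom-++ Γ ((x , B) ∷ [])))
    (proj₁ (unique-contract (dom Γ) (contraction-dom Γ (unique-dom d))))
unique-dom (exch Γ↭Γ′ d)    =
  PermSetoidP.Unique-resp-↭ (setoid Var) (↭⇒↭ₛ (PermP.map⁺ proj₁ Γ↭Γ′)) (unique-dom d)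

∈-++-map : ∀ {A : Set} {z : A} {xs xs′ ys ys′ : List A} →
           (z ∈ xs → z ∈ xs′) → (z ∈ ys → z ∈ ys′) →
           z ∈ xs ++ ys → z ∈ xs′ ++ ys′
∈-++-map {xs = xs} {xs′} f g z∈ with ∈-++⁻ xs z∈
... | inj₁ z∈xs = ∈-++⁺ˡ (f z∈xs)
... | inj₂ z∈ys = ∈-++⁺ʳ xs′ (g z∈ys)

fv-rename : ∀ {K} (x y : Var) (t : Term K) {z} →
            z ∈ FV t → z ≢ y → z ∈ FV (x / y [ t ])
fv-rename x y (var w) (here refl) z≢y with w ≟ y
... | yes w≡y = ⊥-elim (z≢y w≡y)
... | no  _   = here refl
fv-rename x y (lam w Ψ t) z∈ z≢y with w ≟ y
... | yes _ = z∈
... | no  _ with ∈-filter⁻ (λ v → ¬? (v ≟ w)) {xs = FV t} z∈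
...   | z∈t , z≢w = ∈-filter⁺ (λ v → ¬? (v ≟ w)) (fv-rename x y t z∈t z≢y) z≢w
fv-rename x y (app t u) z∈ z≢y =
  ∈-++-map (λ m → fv-rename x y t m z≢y) (λ m → fv-rename x y u m z≢y) z∈
fv-rename x y (plus t u) z∈ z≢y =
  ∈-++-map (λ m → fv-rename x y t m z≢y) (λ m → fv-rename x y u m z≢y) z∈
fv-rename x y (tens t u) z∈ z≢y =
  ∈-++-map (λ m → fv-rename x y t m z≢y) (λ m → fv-rename x y u m z≢y) z∈
fv-rename x y (proj _ t)   z∈ z≢y = fv-rename x y t z∈ z≢y
fv-rename x y (scal _ t)   z∈ z≢y = fv-rename x y t z∈ z≢y
fv-rename x y (head t)     z∈ z≢y = fv-rename x y t z∈ z≢y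
fv-rename x y (tail t)     z∈ z≢y = fv-rename x y t z∈ z≢y
fv-rename x y (cast _ _ t) z∈ z≢y = fv-rename x y t z∈ z≢y

fv-lam : ∀ {K} (x : Var) (Ψ : Ty) (t : Term K) {z} →
         z ∈ FV t → z ≢ x → z ∈ FV (lam x Ψ t)
fv-lam x Ψ t z∈ z≢x = ∈-filter⁺ (λ v → ¬? (v ≟ x)) z∈ z≢x

CoveredBy : List Var → Ctx → Set
CoveredBy L = All (λ entry → IsBase (proj₂ entry) ⊎ proj₁ entry ∈ L)

covered-++ : ∀ {L M : List Var} {Γ Δ : Ctx} →
             CoveredBy L Γ → CoveredBy M Δ → CoveredBy (L ++ M) (Γ ++ Δ)
covered-++ {L} {M} cΓ cΔ = AllP.++⁺ (All.map (widen ∈-++⁺ˡ) cΓ)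
                                    (All.map (widen (∈-++⁺ʳ L)) cΔ)
  where
  widen : ∀ {N : List Var} {z T} → (z ∈ N → z ∈ L ++ M) →
          IsBase T ⊎ z ∈ N → IsBase T ⊎ z ∈ L ++ M
  widen _ (inj₁ b)  = inj₁ b
  widen f (inj₂ z∈) = inj₂ (f z∈)

covered-transfer : ∀ {L M : List Var} {y} (Γ : Ctx) →
                   (∀ {z} → z ∈ L → z ≢ y → z ∈ M) → y ∉ dom Γ →
                   CoveredBy L Γ → CoveredBy M Γ
covered-transfer []             _ _   []         = []
covered-transfer {L} {M} ((z , T) ∷ Γ) f y∉ (cz ∷ cΓ) =
  entry cz ∷ covered-transfer Γ f (λ y∈Γ → y∉ (there y∈Γ)) cΓ
  where
  entry : IsBase T ⊎ z ∈ L → IsBase T ⊎ z ∈ M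
  entry (inj₁ b)  = inj₁ b
  entry (inj₂ z∈) = inj₂ (f z∈ (λ z≡y → y∉ (here (sym z≡y))))

covered-[] : ∀ {Γ : Ctx} → CoveredBy [] Γ → All IsBase (types Γ)
covered-[] c = AllP.map⁺ (All.map (λ { (inj₁ b) → b ; (inj₂ ()) }) c)

-- Only λ-abstraction and contraction lose a free variable,
-- and in both cases that variable is absent from the remaining context.
covered : ∀ {K} {Γ : Ctx} {t : Term K} {A} → Γ ⊢ t ∶ A → CoveredBy (FV t) Γ
covered (ax _)         = inj₂ (here refl) ∷ []
covered (ax0⃗ _)        = []
covered ax|0⟩          = []
covered ax|1⟩          = []
covered axite          = []
covered (sI _ d)       = covered d
covered (meas _ d)     = covered d
covered (sub d _)      = covered d
covered (⊗Er _ d)      = covered d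
covered (⊗El _ d)      = covered d
covered (⇑r d)         = covered d
covered (⇑l d)         = covered d
covered (⇑α _ d)       = covered d
covered (sI⁺ _ d e)    = covered-++ (covered d) (covered e)
covered (⇒E _ d e)     = covered-++ (covered d) (covered e)
covered (⇒ES _ d e)    = covered-++ (covered d) (covered e)
covered (⊗I _ d e)     = covered-++ (covered d) (covered e)
covered (⇑+ _ d e)     = covered-++ (covered d) (covered e)
covered (⇒I {Γ} {x} {Ψ} {t} _ x∉Γ d) =
  covered-transfer Γ (fv-lam x Ψ t) x∉Γ (AllP.++⁻ˡ Γ (covered d))
covered (weak b _ d)   = AllP.++⁺ (covered d) (inj₁ b ∷ [])
covered (contr {Γ} {x} {y} {t = t} b d) =
  AllP.++⁺ (covered-transfer Γ (fv-rename x y t) y∉Γ (AllP.++⁻ˡ Γ (covered d)))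
           (inj₁ b ∷ [])
  where
  y∉Γ : y ∉ dom Γ
  y∉Γ = proj₂ (unique-contract (dom Γ) (contraction-dom Γ (unique-dom d)))
covered (exch Γ↭Γ′ d)  = All-resp-↭ Γ↭Γ′ (covered d)

lemma6 : {K : Set} {Γ : Ctx} {t : Term K} {A : Ty} →
    Γ ⊢ t ∶ A → FV t ≡ [] → All IsBase (types Γ)
lemma6 d closed = covered-[] (subst (λ L → CoveredBy L _) closed (covered d))
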